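{- Let $V = \{v_1,\dots,v_n\}$ be a finite set and let $V' \subseteq V$ with $|V'| \geq 2$. Then there exists an astral $\hat{G}$ on $V$, $\hat{G} \neq K_n$, whose unique maximum-size independent set $I(\hat{G})$ equals $V'$.
   Context: All graphs are simple undirected graphs on the vertex set $V$; $K_n$ is the complete graph on $V$. For a graph $\hat{G} = (V,\hat{E})$ and $v \in V$, let $\hat{G} \setminus v = (V, \hat{E} \cup \{\{v,u\} : u \in V, u \neq v\})$. Astrals (the graphs reachable by the branching procedure when no pruning or fathoming occurs) are defined recursively: the edgeless graph $(V,\emptyset)$ is an astral; if $\hat{G} \neq K_n$ is an astral and $v \in I(\hat{G})$, then $\hat{G} \setminus v$ is an astral. Here, for an astral $\hat{G} \neq K_n$, $I(\hat{G})$ denotes its unique maximum-size independent set (every astral other than $K_n$ has a unique maximal independent set of size $\geq 2$, and it is maximum). -}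

module Defs where

open import Data.Nat using (ℕ; _≤_)
open import Data.Bool using (Bool; true; false; _∨_; _∧_; not)
open import Data.Fin using (Fin; _≟_)
open import Data.Fin.Subset using (Subset; _∈_; ∣_∣)
open import Data.Product using (_×_)
open import Relation.Nullary using (¬_)
open import Relation.Nullary.Decidable using (⌊_⌋)
open import Relation.Binary.PropositionalEquality using (_≡_; _≢_)

-- A graph on the vertex set V = Fin n, given by its Boolean adjacency
-- relation.  All graphs arising below are symmetric and irreflexive.
Graph : ℕ → Set
Graph n = Fin n → Fin n → Bool

_≈G_ : ∀ {n} → Graph n → Graph n → Set
G ≈G H = ∀ x y → G x y ≡ H x y

edgeless : ∀ {n} → Graph n
edgeless _ _ = false

complete : ∀ {n} → Graph n
complete x y = not ⌊ x ≟ y ⌋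

-- Ĝ \ v : add all edges {v,u}, u ≠ v.
_∖_ : ∀ {n} → Graph n → Fin n → Graph n
(G ∖ v) x y = G x y ∨ ((⌊ x ≟ v ⌋ ∨ ⌊ y ≟ v ⌋) ∧ not ⌊ x ≟ y ⌋)

Independent : ∀ {n} → Graph n → Subset n → Set
Independent G S = ∀ x y → x ∈ S → y ∈ S → x ≢ y → G x y ≡ false

IsUniqueMaxIndep : ∀ {n} → Graph n → Subset n → Set
IsUniqueMaxIndep G S =
  Independent G S ×
  (∀ T → Independent G T → ∣ T ∣ ≤ ∣ S ∣ × (∣ S ∣ ≤ ∣ T ∣ → T ≡ S))

-- Astrals.  The step constructor takes S = I(Ĝ), i.e. the unique
-- maximum-size independent set of Ĝ, and a vertex v ∈ I(Ĝ).
data Astral {n : ℕ} : Graph n → Set where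
  base : Astral edgeless
  step : ∀ {G : Graph n} (S : Subset n) (v : Fin n) →
         Astral G → ¬ (G ≈G complete) → IsUniqueMaxIndep G S → v ∈ S →
         Astral (G ∖ v)

-- The astrals used are the complete split graphs: for S ⊆ V let
-- splitGraph S join two distinct vertices unless both lie in S, so S is
-- independent and V ∖ S is a clique joined to everything.
--   * If |S| ≥ 2, then splitGraph S ≠ Kₙ and S is its unique maximum
--     independent set: an independent set meeting V ∖ S is a singleton,
--     and any other one is contained in S.
--   * Removing v (adding all edges at v) gives splitGraph S ∖ v =
--     splitGraph (S - v).
--   * The edgeless graph is splitGraph ⊤.
-- Starting from the edgeless graph and removing the vertices outside V′
-- one by one (walking through the list of all vertices) therefore stays
-- among astrals and ends at splitGraph V′, which is the required graph.
-- Astral is indexed by adjacency functions, so the invariant is carried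
-- up to edge equality _≈G_, which all notions involved respect.
module Submission where

open import Defs
open import Data.Nat using (ℕ; _≤_; z≤n; s≤s)
open import Data.Nat.Properties using (≤-trans; ≤-reflexive; <⇒≱)
open import Data.Bool using (Bool; true; false; _∨_; _∧_; not)
open import Data.Bool.Properties using (∧-zeroʳ; ∧-distribʳ-∨)
open import Data.Fin using (Fin; _≟_)
open import Data.Fin.Properties using (any?)
open import Data.Fin.Subset using (Subset; _∈_; _∉_; _⊆_; _─_; _-_; ⁅_⁆; ⊤; ⊥; ∣_∣; inside)
open import Data.Fin.Subset.Properties
  using (_∈?_; ⊆-antisym; p⊆q⇒∣p∣≤∣q∣; p⊂q⇒∣p∣<∣q∣; p─q⊆p;
         x∈p∧x≢y⇒x∈p-y; x∈⁅x⁆; ∣⁅x⁆∣≡1; ∣⊥∣≡0; ∈⊤)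
open import Data.List using (List; []; _∷_; allFin)
open import Data.List.Relation.Unary.Any using (tail)
open import Data.List.Membership.Propositional using () renaming (_∈_ to _∈ˡ_)
open import Data.List.Membership.Propositional.Properties using (∈-allFin)
open import Data.Product using (Σ; _×_; _,_; proj₁; proj₂)
open import Data.Sum using (_⊎_; inj₁; inj₂)
open import Data.Vec using (_∷_; here; there)
open import Data.Empty using (⊥-elim)
open import Function using (_∘_)
open import Relation.Nullary using (Dec; ¬_; yes; no; contradiction)
open import Relation.Nullary.Decidable using (⌊_⌋; _×-dec_; ¬?; dec-true; dec-false; isYes≗does)
open import Relation.Binary.PropositionalEquality using (_≡_; _≢_; refl; sym; trans; subst; cong)

private
  variable
    n : ℕ

∣∣≤1 : (S : Subset n) → (∀ {x y} → x ∈ S → y ∈ S → x ≡ y) → ∣ S ∣ ≤ 1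
∣∣≤1 {n} S allEqual with any? (_∈? S)
... | yes (x , x∈S) = ≤-trans (p⊆q⇒∣p∣≤∣q∣ S⊆⁅x⁆) (≤-reflexive (∣⁅x⁆∣≡1 x))
  where
  S⊆⁅x⁆ : S ⊆ ⁅ x ⁆
  S⊆⁅x⁆ y∈S = subst (_∈ ⁅ x ⁆) (allEqual x∈S y∈S) (x∈⁅x⁆ x)
... | no empty = ≤-trans (p⊆q⇒∣p∣≤∣q∣ S⊆⊥) (≤-trans (≤-reflexive (∣⊥∣≡0 n)) z≤n)
  where
  S⊆⊥ : S ⊆ ⊥
  S⊆⊥ {y} y∈S = ⊥-elim (empty (y , y∈S))

⊆-∣∣-antisym : {T S : Subset n} → T ⊆ S → ∣ S ∣ ≤ ∣ T ∣ → T ≡ S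
⊆-∣∣-antisym {T = T} {S} T⊆S ∣S∣≤∣T∣ with any? (λ x → x ∈? S ×-dec ¬? (x ∈? T))
... | yes (x , x∈S , x∉T) = contradiction ∣S∣≤∣T∣ (<⇒≱ (p⊂q⇒∣p∣<∣q∣ (T⊆S , x , x∈S , x∉T)))
... | no noneMissing = ⊆-antisym T⊆S S⊆T
  where
  S⊆T : S ⊆ T
  S⊆T {x} x∈S with x ∈? T
  ... | yes x∈T = x∈T
  ... | no x∉T = ⊥-elim (noneMissing (x , x∈S , x∉T))

x∈p─q⇒x∉q : {x : Fin n} {p q : Subset n} → x ∈ p ─ q → x ∉ q
x∈p─q⇒x∉q {p = _ ∷ _} {q = inside ∷ _} () here
x∈p─q⇒x∉q {p = _ ∷ p} {q = _ ∷ q} (there x∈p─q) (there x∈q) = x∈p─q⇒x∉q {p = p} {q} x∈p─q x∈q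

⌊⌋-true : {A : Set} (a? : Dec A) → A → ⌊ a? ⌋ ≡ true
⌊⌋-true a? a = trans (isYes≗does a?) (dec-true a? a)

⌊⌋-false : {A : Set} (a? : Dec A) → ¬ A → ⌊ a? ⌋ ≡ false
⌊⌋-false a? ¬a = trans (isYes≗does a?) (dec-false a? ¬a)

_∈ᵇ_ : Fin n → Subset n → Bool
x ∈ᵇ S = ⌊ x ∈? S ⌋

∈ᵇ-remove : (x v : Fin n) (S : Subset n) → x ∈ᵇ (S - v) ≡ x ∈ᵇ S ∧ not ⌊ x ≟ v ⌋
∈ᵇ-remove x v S with x ∈? S | x ≟ v
... | yes x∈S | yes refl = ⌊⌋-false (x ∈? S - x) (λ x∈S-x → x∈p─q⇒x∉q {p = S} x∈S-x (x∈⁅x⁆ x))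
... | yes x∈S | no x≢v = ⌊⌋-true (x ∈? S - v) (x∈p∧x≢y⇒x∈p-y x∈S x≢v)
... | no x∉S | _ = ⌊⌋-false (x ∈? S - v) (x∉S ∘ p─q⊆p S ⁅ v ⁆)

≈G-sym : {G H : Graph n} → G ≈G H → H ≈G G
≈G-sym G≈H x y = sym (G≈H x y)

Independent-resp : {G H : Graph n} {S : Subset n} → G ≈G H → Independent G S → Independent H S
Independent-resp G≈H indG x y x∈S y∈S x≢y = trans (sym (G≈H x y)) (indG x y x∈S y∈S x≢y)

IsUniqueMaxIndep-resp : {G H : Graph n} {S : Subset n} → G ≈G H → IsUniqueMaxIndep H S → IsUniqueMaxIndep G S
IsUniqueMaxIndep-resp G≈H (indH , maxH) =
  Independent-resp (≈G-sym G≈H) indH , λ T indT → maxH T (Independent-resp G≈H indT)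

notComplete-resp : {G H : Graph n} → G ≈G H → ¬ (H ≈G complete) → ¬ (G ≈G complete)
notComplete-resp G≈H H≉K G≈K = H≉K (λ x y → trans (sym (G≈H x y)) (G≈K x y))

∖-resp : {G H : Graph n} (v : Fin n) → G ≈G H → (G ∖ v) ≈G (H ∖ v)
∖-resp v G≈H x y = cong (_∨ _) (G≈H x y)

Independent-complete : (S : Subset n) → Independent complete S → ∣ S ∣ ≤ 1
Independent-complete S indS = ∣∣≤1 S equal
  where
  equal : ∀ {x y} → x ∈ S → y ∈ S → x ≡ y
  equal {x} {y} x∈S y∈S with x ≟ y
  ... | yes x≡y = x≡y
  ... | no x≢y with () ← trans (sym (indS x y x∈S y∈S x≢y)) (cong not (⌊⌋-false (x ≟ y) x≢y))

splitGraph : Subset n → Graph n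
splitGraph S x y = not (x ∈ᵇ S ∧ y ∈ᵇ S) ∧ not ⌊ x ≟ y ⌋

splitGraph-independent : (S : Subset n) → Independent (splitGraph S) S
splitGraph-independent S x y x∈S y∈S _
  rewrite ⌊⌋-true (x ∈? S) x∈S | ⌊⌋-true (y ∈? S) y∈S = refl

splitGraph-outside : (S : Subset n) {x y : Fin n} → x ∉ S → y ≢ x → splitGraph S y x ≡ true
splitGraph-outside S {x} {y} x∉S y≢x
  rewrite ⌊⌋-false (x ∈? S) x∉S | ∧-zeroʳ (y ∈ᵇ S) | ⌊⌋-false (y ≟ x) y≢x = refl

splitGraph-independents : (S T : Subset n) → Independent (splitGraph S) T → T ⊆ S ⊎ ∣ T ∣ ≤ 1
splitGraph-independents S T indT with any? (λ x → x ∈? T ×-dec ¬? (x ∈? S))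
... | yes (x , x∈T , x∉S) = inj₂ (∣∣≤1 T (λ y∈T z∈T → trans (isX y∈T) (sym (isX z∈T))))
  where
  isX : ∀ {y} → y ∈ T → y ≡ x
  isX {y} y∈T with y ≟ x
  ... | yes y≡x = y≡x
  ... | no y≢x with () ← trans (sym (indT y x y∈T x∈T y≢x)) (splitGraph-outside S x∉S y≢x)
... | no noneOutside = inj₁ T⊆S
  where
  T⊆S : T ⊆ S
  T⊆S {x} x∈T with x ∈? S
  ... | yes x∈S = x∈S
  ... | no x∉S = ⊥-elim (noneOutside (x , x∈T , x∉S))

2≰1 : ¬ (2 ≤ 1)
2≰1 (s≤s ())

splitGraph-uniqueMax : (S : Subset n) → 2 ≤ ∣ S ∣ → IsUniqueMaxIndep (splitGraph S) S
splitGraph-uniqueMax S 2≤∣S∣ = splitGraph-independent S , maximum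
  where
  maximum : ∀ T → Independent (splitGraph S) T → ∣ T ∣ ≤ ∣ S ∣ × (∣ S ∣ ≤ ∣ T ∣ → T ≡ S)
  maximum T indT with splitGraph-independents S T indT
  ... | inj₁ T⊆S = p⊆q⇒∣p∣≤∣q∣ T⊆S , ⊆-∣∣-antisym T⊆S
  ... | inj₂ ∣T∣≤1 = ≤-trans ∣T∣≤1 (≤-trans (s≤s z≤n) 2≤∣S∣)
                   , λ ∣S∣≤∣T∣ → ⊥-elim (2≰1 (≤-trans 2≤∣S∣ (≤-trans ∣S∣≤∣T∣ ∣T∣≤1)))

splitGraph-notComplete : (S : Subset n) → 2 ≤ ∣ S ∣ → ¬ (splitGraph S ≈G complete)
splitGraph-notComplete S 2≤∣S∣ split≈K =
  2≰1 (≤-trans 2≤∣S∣ (Independent-complete S (Independent-resp split≈K (splitGraph-independent S))))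

splitGraph-∖ : (S : Subset n) (v : Fin n) → (splitGraph S ∖ v) ≈G splitGraph (S - v)
splitGraph-∖ S v x y
  rewrite ∈ᵇ-remove x v S | ∈ᵇ-remove y v S =
    trans (sym (∧-distribʳ-∨ (not ⌊ x ≟ y ⌋) (not (x ∈ᵇ S ∧ y ∈ᵇ S)) (⌊ x ≟ v ⌋ ∨ ⌊ y ≟ v ⌋)))
          (cong (_∧ not ⌊ x ≟ y ⌋) (adjacency (x ∈ᵇ S) (y ∈ᵇ S) ⌊ x ≟ v ⌋ ⌊ y ≟ v ⌋))
  where
  -- x, y are non-adjacent after the removal iff both are in S and
  -- neither is v.
  adjacency : ∀ a b c d → not (a ∧ b) ∨ (c ∨ d) ≡ not ((a ∧ not c) ∧ (b ∧ not d))
  adjacency false b     c     d     = refl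
  adjacency true  false false d     = refl
  adjacency true  false true  d     = refl
  adjacency true  true  true  d     = refl
  adjacency true  true  false false = refl
  adjacency true  true  false true  = refl

SplitAstral : {n : ℕ} → Subset n → Set
SplitAstral {n} S = Σ (Graph n) λ G → Astral G × G ≈G splitGraph S

splitAstral-⊤ : SplitAstral (⊤ {n})
splitAstral-⊤ = edgeless , base , edgeless≈split
  where
  edgeless≈split : edgeless ≈G splitGraph ⊤
  edgeless≈split x y rewrite ⌊⌋-true (x ∈? ⊤) ∈⊤ | ⌊⌋-true (y ∈? ⊤) ∈⊤ = refl

splitAstral-remove : {S : Subset n} {v : Fin n} → 2 ≤ ∣ S ∣ → v ∈ S → SplitAstral S → SplitAstral (S - v)
splitAstral-remove {S = S} {v} 2≤∣S∣ v∈S (G , astralG , G≈split) =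
  G ∖ v ,
  step S v astralG (notComplete-resp G≈split (splitGraph-notComplete S 2≤∣S∣))
                   (IsUniqueMaxIndep-resp G≈split (splitGraph-uniqueMax S 2≤∣S∣)) v∈S ,
  λ x y → trans (∖-resp v G≈split x y) (splitGraph-∖ S v x y)

splitAstral-peel : {V′ : Subset n} → 2 ≤ ∣ V′ ∣ → (L : List (Fin n)) {S : Subset n} → V′ ⊆ S →
                   (∀ {x} → x ∈ S → x ∉ V′ → x ∈ˡ L) → SplitAstral S → SplitAstral V′
splitAstral-peel {V′ = V′} 2≤∣V′∣ [] {S} V′⊆S surplus⊆[] astralS =
  subst SplitAstral (⊆-antisym S⊆V′ V′⊆S) astralS
  where
  S⊆V′ : S ⊆ V′
  S⊆V′ {x} x∈S with x ∈? V′
  ... | yes x∈V′ = x∈V′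
  ... | no x∉V′ with () ← surplus⊆[] x∈S x∉V′
splitAstral-peel {V′ = V′} 2≤∣V′∣ (v ∷ L) {S} V′⊆S surplus⊆vL astralS
  with v ∈? S ×-dec ¬? (v ∈? V′)
... | yes (v∈S , v∉V′) =
  splitAstral-peel 2≤∣V′∣ L V′⊆S-v surplus⊆L
    (splitAstral-remove (≤-trans 2≤∣V′∣ (p⊆q⇒∣p∣≤∣q∣ V′⊆S)) v∈S astralS)
  where
  V′⊆S-v : V′ ⊆ S - v
  V′⊆S-v {x} x∈V′ = x∈p∧x≢y⇒x∈p-y (V′⊆S x∈V′) (λ { refl → v∉V′ x∈V′ })
  surplus⊆L : ∀ {x} → x ∈ S - v → x ∉ V′ → x ∈ˡ L
  surplus⊆L {x} x∈S-v x∉V′ =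
    tail (λ { refl → x∈p─q⇒x∉q {p = S} x∈S-v (x∈⁅x⁆ x) }) (surplus⊆vL (p─q⊆p S ⁅ v ⁆ x∈S-v) x∉V′)
... | no ¬removable = splitAstral-peel 2≤∣V′∣ L V′⊆S surplus⊆L astralS
  where
  surplus⊆L : ∀ {x} → x ∈ S → x ∉ V′ → x ∈ˡ L
  surplus⊆L x∈S x∉V′ = tail (λ { refl → ¬removable (x∈S , x∉V′) }) (surplus⊆vL x∈S x∉V′)

mainTheorem4 : (n : ℕ) (V′ : Subset n) → 2 ≤ ∣ V′ ∣ →
    Σ (Graph n) (λ G → Astral G × ¬ (G ≈G complete) × IsUniqueMaxIndep G V′)
mainTheorem4 n V′ 2≤∣V′∣ =
  G , astralG ,
  notComplete-resp G≈split (splitGraph-notComplete V′ 2≤∣V′∣) ,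
  IsUniqueMaxIndep-resp G≈split (splitGraph-uniqueMax V′ 2≤∣V′∣)
  where
  peeled : SplitAstral V′
  peeled = splitAstral-peel 2≤∣V′∣ (allFin n) (λ _ → ∈⊤) (λ {x} _ _ → ∈-allFin x) splitAstral-⊤

  G : Graph n
  G = proj₁ peeled
  astralG : Astral G
  astralG = proj₁ (proj₂ peeled)
  G≈split : G ≈G splitGraph V′
  G≈split = proj₂ (proj₂ peeled)
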